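{- For all integers $n\ge 4$, $$\sum_{j=0}^{\lfloor n/2\rfloor}\chi^{(n-j,j)}\big(2\,2\,1^{n-4}\big)^2=\frac{n^4-14n^3+89n^2-316n+525}{(2n-1)(2n-3)(2n-5)(2n-7)(n+1)}\binom{2n}{n}.$$
   Context: For partitions $\lambda,\mu$ of $n$, $\chi^{\lambda}(\mu)$ is the value of the irreducible character of $S_n$ indexed by $\lambda$ on permutations of cycle type $\mu$. $(n-j,j)$ is the shape with rows $n-j$ and $j$ (one row when $j=0$); $2\,2\,1^{n-4}$ is the partition of $n$ with two parts $2$ and $n-4$ parts $1$. -}

module Defs where

open import Data.Nat as ℕ using (ℕ; zero; suc; _∸_; _<ᵇ_; _≡ᵇ_; _≤ᵇ_)
open import Data.Integer as ℤ using (ℤ; +_; -_)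
open import Data.Bool using (Bool; true; false; if_then_else_; _∧_; _∨_; not)
open import Data.List using (List; []; _∷_; length; replicate; foldr; map; upTo)

-- A partition is a weakly decreasing list of positive naturals.
Partition : Set
Partition = List ℕ

sumℤ : List ℤ → ℤ
sumℤ = foldr ℤ._+_ (+ 0)

sign : ℕ → ℤ
sign zero = + 1
sign (suc k) = - sign k

-- Beta-set (first-column hook lengths) of λ = (λ₁,…,λℓ):
-- βᵢ = λᵢ + ℓ - i.
beta : Partition → List ℕ
beta [] = []
beta (x ∷ xs) = (x ℕ.+ length xs) ∷ beta xs

anyᵇ allᵇ : (ℕ → Bool) → List ℕ → Bool
anyᵇ p [] = false
anyᵇ p (x ∷ xs) = p x ∨ anyᵇ p xs
allᵇ p [] = true
allᵇ p (x ∷ xs) = p x ∧ allᵇ p xs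

_∈ᵇ_ : ℕ → List ℕ → Bool
x ∈ᵇ B = anyᵇ (λ c → x ≡ᵇ c) B

between : ℕ → ℕ → List ℕ → ℕ
between a b [] = 0
between a b (c ∷ cs) = (if (a <ᵇ c) ∧ (c <ᵇ b) then 1 else 0) ℕ.+ between a b cs

replace : ℕ → ℕ → List ℕ → List ℕ
replace b b' [] = []
replace b b' (c ∷ cs) = (if b ≡ᵇ c then b' else c) ∷ replace b b' cs

-- Murnaghan–Nakayama rule on beta-sets: removing a rim hook of length k
-- from λ is replacing a bead b of the beta-set by b - k (when b ≥ k and
-- b - k is not a bead); its leg length is the number of beads strictly
-- between b - k and b.
mutual
  mn : List ℕ → List ℕ → ℤ
  mn B [] = if allᵇ (λ c → c <ᵇ length B) B then + 1 else + 0   -- λ empty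
  mn B (k ∷ μ) = mnSum B B k μ

  -- sum over beads b of (the full beta-set) B
  mnSum : List ℕ → List ℕ → ℕ → List ℕ → ℤ
  mnSum B [] k μ = + 0
  mnSum B (b ∷ bs) k μ =
    (if (k ≤ᵇ b) ∧ not ((b ∸ k) ∈ᵇ B) ∧ not (k ≡ᵇ 0)
       then sign (between (b ∸ k) b B) ℤ.* mn (replace b (b ∸ k) B) μ
       else + 0)
    ℤ.+ mnSum B bs k μ

χ : Partition → Partition → ℤ
χ la μ = mn (beta la) μ

twoRow : ℕ → ℕ → Partition
twoRow n zero = n ∷ []
twoRow n (suc j) = (n ∸ suc j) ∷ suc j ∷ []

type221 : ℕ → Partition
type221 n = 2 ∷ 2 ∷ replicate (n ∸ 4) 1

lhs : ℕ → ℤ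
lhs n = sumℤ (map (λ j → χ (twoRow n j) (type221 n) ℤ.* χ (twoRow n j) (type221 n))
                  (upTo (ℕ._/_ n 2 ℕ.+ 1)))

module Submission where

{-
On a beta-set with two beads x > y, x + y = |μ| + 1, the Murnaghan–Nakayama
rule for μ = (k, μ′) is a two-term recursion, solved by the coefficient c_μ(y)
of X^y in (1 - X) ∏ᵢ (1 + X^μᵢ): removing the k-hook from the lower bead
contributes c_μ′(y - k), and removing it from the upper bead contributes
c_μ′(y), because c_μ′ is antisymmetric under y ↦ |μ′| + 1 - y; this accounts
for the sign when the hook passes the lower bead and for the vanishing when it
lands on it. Hence, with n = m + 4, χ^(n-j,j)(2 2 1^m) = Σₖ cₖ C(m, j - k)
where (cₖ) = (1, -1, 2, -2, 1, -1).

By the same antisymmetry, twice the sum over j ≤ n/2 of the squared characters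
is the sum over all j, which Vandermonde's identity turns into
Σ_d w_d C(2m, m + d) with w = (12, -20, 16, -10, 4, -2); likewise
C(2n, n) = Σᵢ C(8, i) C(2m, m + 4 - i). Finally
(m + 1)⋯(m + d) C(2m, m + d) = m(m - 1)⋯(m - d + 1) C(2m, m), so after
multiplying by (m + 1)⋯(m + 5) both sides of the theorem become polynomial
multiples of C(2m, m), and what remains is an identity between polynomials in m.
-}

open import Defs
open import Data.Nat as ℕ using (ℕ; _≤_)
open import Data.Nat.Combinatorics using (_C_)
open import Data.Integer using (ℤ; +_; _-_; _*_; _+_; _^_)
open import Relation.Binary.PropositionalEquality using (_≡_)

open import Data.Bool using (true; false; T; not; _∧_; _∨_; if_then_else_)
open import Data.Bool.Properties using (T-≡; T-∨; ¬-not; ∧-zeroʳ)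
open import Data.Integer using (-[1+_]; -_; _⊖_; NonZero)
import Data.Integer.Properties as ℤ
open import Data.Integer.Tactic.RingSolver using (solve-∀; solve)
open import Data.List using (List; []; _∷_; map; applyUpTo; replicate)
open import Data.List.Membership.Propositional using (_∈_; _∉_)
open import Data.List.Relation.Unary.All as All using (All)
open import Data.List.Relation.Unary.All.Properties using (replicate⁺)
open import Data.List.Relation.Unary.Any using (here; there)
open import Data.Nat using (zero; suc; _<_; _∸_; _/_; s≤s; z≤n; _≤ᵇ_; _<ᵇ_; _≡ᵇ_)
open import Data.Nat.Combinatorics using (nCk+nC[k+1]≡[n+1]C[k+1]; nCk≡nC[n∸k]; k>n⇒nCk≡0; nC1≡n)
open import Data.Nat.DivMod using (m/n≡1+[m∸n]/n; m/n*n≤m)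
open import Data.Nat.ListAction using (sum)
import Data.Nat.Properties as ℕ
import Data.Nat.Tactic.RingSolver as ℕ-Solver
open import Data.Sum using (inj₁; inj₂)
open import Function.Base using (_∘_)
open import Function.Bundles using (Equivalence)
open import Relation.Binary.Definitions using (tri<; tri≈; tri>)
open import Relation.Binary.PropositionalEquality
  using (_≢_; refl; sym; trans; cong; cong₂; subst; module ≡-Reasoning)
open import Relation.Nullary using (yes; no; ¬_)

-- Binomial coefficients with an integer lower index

binom : ℕ → ℤ → ℤ
binom n (+ k)    = + (n C k)
binom n -[1+ _ ] = + 0

pos-∸ : ∀ {m n} → n ≤ m → + m - + n ≡ + (m ∸ n)
pos-∸ {m} {n} n≤m = trans (ℤ.m-n≡m⊖n m n) (ℤ.⊖-≥ n≤m)

m-[1+n]≡-[1+n∸m] : ∀ {m n} → m < suc n → + m - + suc n ≡ -[1+ n ∸ m ]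
m-[1+n]≡-[1+n∸m] {m} {n} (s≤s m≤n) = begin
  + m - + suc n    ≡⟨ ℤ.m-n≡m⊖n m (suc n) ⟩
  m ⊖ suc n        ≡⟨ ℤ.⊖-< (s≤s m≤n) ⟩
  - + (suc n ∸ m)  ≡⟨ cong (λ d → - + d) (ℕ.+-∸-assoc 1 m≤n) ⟩
  -[1+ n ∸ m ]     ∎
  where open ≡-Reasoning

m+n≡o⇒n≡o-m : ∀ {m n o} → m ℕ.+ n ≡ o → + n ≡ + o - + m
m+n≡o⇒n≡o-m {m} {n} {o} eq = begin
  + n              ≡⟨ cancel (+ m) (+ n) ⟩
  + m + + n - + m  ≡⟨ cong (_- + m) (trans (sym (ℤ.pos-+ m n)) (cong +_ eq)) ⟩
  + o - + m        ∎
  where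
  open ≡-Reasoning
  cancel : ∀ m n → n ≡ m + n - m
  cancel = solve-∀

binom-above : ∀ n {k} → n < k → binom n (+ k) ≡ + 0
binom-above n n<k = cong +_ (k>n⇒nCk≡0 n<k)

binom-below : ∀ n {i k} → i < k → binom n (+ i - + k) ≡ + 0
binom-below n {k = suc k} i<k = cong (binom n) (m-[1+n]≡-[1+n∸m] i<k)

binom-pascal : ∀ n k → binom (suc n) k ≡ binom n k + binom n (k - + 1)
binom-pascal n (+ zero)  = refl
binom-pascal n (+ suc k) = trans (cong +_ (sym (nCk+nC[k+1]≡[n+1]C[k+1] n k)))
                                 (ℤ.+-comm (+ (n C k)) (+ (n C suc k)))
binom-pascal n -[1+ k ]  = refl

binom-sym : ∀ n k → binom n k ≡ binom n (+ n - k)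
binom-sym n (+ k) with k ℕ.≤? n
... | yes k≤n = trans (cong +_ (nCk≡nC[n∸k] k≤n)) (cong (binom n) (sym (pos-∸ k≤n)))
... | no  k≰n = trans (binom-above n (ℕ.≰⇒> k≰n)) (sym (binom-below n (ℕ.≰⇒> k≰n)))
binom-sym n -[1+ k ] = sym (binom-above n (ℕ.m<m+n n {suc k} (s≤s z≤n)))

binom-absorb : ∀ n k → + suc k * binom n (+ suc k) ≡ (+ n - + k) * binom n (+ k)
binom-absorb n       zero    = begin
  + 1 * + (n C 1)  ≡⟨ ℤ.*-identityˡ _ ⟩
  + (n C 1)        ≡⟨ cong +_ (nC1≡n n) ⟩
  + n              ≡⟨ sym (trans (ℤ.*-identityʳ _) (ℤ.+-identityʳ (+ n))) ⟩
  (+ n - + 0) * + 1 ∎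
  where open ≡-Reasoning
binom-absorb zero    (suc k) = trans (ℤ.*-zeroʳ (+ suc (suc k))) (sym (ℤ.*-zeroʳ (+ 0 - + suc k)))
-- + suc k is written as the definitionally equal + 1 + + k so that the ring solver sees k as a variable.
binom-absorb (suc n) (suc k) = begin
  (+ 1 + (+ 1 + + k)) * binom (suc n) (+ suc (suc k))
    ≡⟨ cong ((+ 1 + (+ 1 + + k)) *_) (binom-pascal n (+ suc (suc k))) ⟩
  (+ 1 + (+ 1 + + k)) * (binom n (+ suc (suc k)) + binom n (+ suc k))
    ≡⟨ pascal-step (+ k) (+ n) (binom n (+ suc (suc k))) (binom n (+ suc k)) (binom n (+ k))
         (binom-absorb n (suc k)) (binom-absorb n k) ⟩
  ((+ 1 + + n) - (+ 1 + + k)) * (binom n (+ suc k) + binom n (+ k))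
    ≡⟨ cong ((+ suc n - + suc k) *_) (sym (binom-pascal n (+ suc k))) ⟩
  (+ suc n - + suc k) * binom (suc n) (+ suc k) ∎
  where
  open ≡-Reasoning
  pascal-step : ∀ (K N a b c : ℤ) →
    (+ 1 + (+ 1 + K)) * a ≡ (N - (+ 1 + K)) * b → (+ 1 + K) * b ≡ (N - K) * c →
    (+ 1 + (+ 1 + K)) * (a + b) ≡ ((+ 1 + N) - (+ 1 + K)) * (b + c)
  pascal-step K N a b c absorb₁ absorb₀ = begin
    (+ 1 + (+ 1 + K)) * (a + b)              ≡⟨ solve (K ∷ a ∷ b ∷ []) ⟩
    (+ 1 + (+ 1 + K)) * a + (+ 2 + K) * b    ≡⟨ cong (_+ (+ 2 + K) * b) absorb₁ ⟩
    (N - (+ 1 + K)) * b + (+ 2 + K) * b      ≡⟨ solve (K ∷ N ∷ b ∷ []) ⟩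
    (N - K) * b + (+ 1 + K) * b              ≡⟨ cong (_+_ ((N - K) * b)) absorb₀ ⟩
    (N - K) * b + (N - K) * c                ≡⟨ solve (K ∷ N ∷ b ∷ c ∷ []) ⟩
    ((+ 1 + N) - (+ 1 + K)) * (b + c)        ∎

-- The clause for 1 avoids a factor + 1, so that for a literal d these unfold to exactly the products
-- written out in scale-by-rising.
rising : ℤ → ℕ → ℤ
rising x zero                = + 1
rising x (suc zero)          = x + + 1
rising x (suc d@(suc _))     = rising x d * (x + + suc d)

falling : ℤ → ℕ → ℤ
falling x zero               = + 1
falling x (suc zero)         = x
falling x (suc d@(suc _))    = falling x d * (x - + d)

rising-suc : ∀ x d → rising x (suc d) ≡ rising x d * (x + + suc d)
rising-suc x zero    = sym (ℤ.*-identityˡ (x + + 1))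
rising-suc x (suc d) = refl

falling-suc : ∀ x d → falling x (suc d) ≡ falling x d * (x - + d)
falling-suc x zero    = sym (trans (ℤ.*-identityˡ (x - + 0)) (ℤ.+-identityʳ x))
falling-suc x (suc d) = refl

binom-rising : ∀ n k d → rising (+ k) d * binom n (+ (k ℕ.+ d)) ≡ falling (+ n - + k) d * binom n (+ k)
binom-rising n k zero    = cong (λ i → + 1 * binom n (+ i)) (ℕ.+-identityʳ k)
binom-rising n k (suc d) = begin
  rising (+ k) (suc d) * binom n (+ (k ℕ.+ suc d))
    ≡⟨ cong₂ (λ r i → r * binom n (+ i)) (rising-suc (+ k) d) (ℕ.+-suc k d) ⟩
  rising (+ k) d * (+ k + + suc d) * binom n (+ suc (k ℕ.+ d))
    ≡⟨ ℤ.*-assoc (rising (+ k) d) (+ k + + suc d) (binom n (+ suc (k ℕ.+ d))) ⟩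
  rising (+ k) d * ((+ k + + suc d) * binom n (+ suc (k ℕ.+ d)))
    ≡⟨ cong (λ s → rising (+ k) d * (s * binom n (+ suc (k ℕ.+ d)))) (cong +_ (ℕ.+-suc k d)) ⟩
  rising (+ k) d * (+ suc (k ℕ.+ d) * binom n (+ suc (k ℕ.+ d)))
    ≡⟨ cong (rising (+ k) d *_) (binom-absorb n (k ℕ.+ d)) ⟩
  rising (+ k) d * ((+ n - + (k ℕ.+ d)) * binom n (+ (k ℕ.+ d)))
    ≡⟨ exchange (rising (+ k) d) (+ n - + (k ℕ.+ d)) (binom n (+ (k ℕ.+ d))) ⟩
  (+ n - + (k ℕ.+ d)) * (rising (+ k) d * binom n (+ (k ℕ.+ d)))
    ≡⟨ cong ((+ n - + (k ℕ.+ d)) *_) (binom-rising n k d) ⟩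
  (+ n - + (k ℕ.+ d)) * (falling (+ n - + k) d * binom n (+ k))
    ≡⟨ regroup (+ n) (+ k) (+ d) (falling (+ n - + k) d) (binom n (+ k)) ⟩
  falling (+ n - + k) d * (+ n - + k - + d) * binom n (+ k)
    ≡⟨ cong (_* binom n (+ k)) (falling-suc (+ n - + k) d) ⟨
  falling (+ n - + k) (suc d) * binom n (+ k) ∎
  where
  open ≡-Reasoning
  exchange : ∀ r s t → r * (s * t) ≡ s * (r * t)
  exchange = solve-∀
  regroup : ∀ N K D f c → (N - (K + D)) * (f * c) ≡ f * (N - K - D) * c
  regroup = solve-∀

rising-nonZero : ∀ m d → NonZero (rising (+ m) d)
rising-nonZero m zero    = _
rising-nonZero m (suc d) = subst NonZero (sym (rising-suc (+ m) d))
  (ℤ.i*j≢0 (rising (+ m) d) (+ m + + suc d) {{rising-nonZero m d}}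
           {{ℕ.>-nonZero (ℕ.<-≤-trans (s≤s z≤n) (ℕ.m≤n+m (suc d) m))}})

-- Finite sums

∑ : ℕ → (ℕ → ℤ) → ℤ
∑ zero    f = + 0
∑ (suc n) f = f 0 + ∑ n (λ i → f (suc i))

syntax ∑ n (λ i → e) = ∑[ i < n ] e

∑-cong : ∀ n {f g : ℕ → ℤ} → (∀ i → i < n → f i ≡ g i) → ∑ n f ≡ ∑ n g
∑-cong zero    eq = refl
∑-cong (suc n) eq = cong₂ _+_ (eq 0 (s≤s z≤n)) (∑-cong n (λ i i<n → eq (suc i) (s≤s i<n)))

∑-zero : ∀ n {f : ℕ → ℤ} → (∀ i → i < n → f i ≡ + 0) → ∑ n f ≡ + 0
∑-zero zero    eq = refl
∑-zero (suc n) eq = cong₂ _+_ (eq 0 (s≤s z≤n)) (∑-zero n (λ i i<n → eq (suc i) (s≤s i<n)))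

∑-+ : ∀ n (f g : ℕ → ℤ) → ∑[ i < n ] (f i + g i) ≡ ∑ n f + ∑ n g
∑-+ zero    f g = refl
∑-+ (suc n) f g = trans (cong (_+_ (f 0 + g 0)) (∑-+ n _ _)) (interchange (f 0) (g 0) _ _)
  where
  interchange : ∀ a b c d → (a + b) + (c + d) ≡ (a + c) + (b + d)
  interchange = solve-∀

∑-*ˡ : ∀ n c (f : ℕ → ℤ) → ∑[ i < n ] (c * f i) ≡ c * ∑ n f
∑-*ˡ zero    c f = sym (ℤ.*-zeroʳ c)
∑-*ˡ (suc n) c f = trans (cong (_+_ (c * f 0)) (∑-*ˡ n c _)) (sym (ℤ.*-distribˡ-+ c (f 0) _))

∑-*ʳ : ∀ n (f : ℕ → ℤ) c → ∑[ i < n ] (f i * c) ≡ ∑ n f * c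
∑-*ʳ n f c = trans (∑-cong n (λ i _ → ℤ.*-comm (f i) c)) (trans (∑-*ˡ n c f) (ℤ.*-comm c (∑ n f)))

∑-swap : ∀ m n (F : ℕ → ℕ → ℤ) → ∑[ i < m ] ∑[ j < n ] F i j ≡ ∑[ j < n ] ∑[ i < m ] F i j
∑-swap zero    n F = sym (∑-zero n (λ _ _ → refl))
∑-swap (suc m) n F = trans (cong (_+_ (∑ n (F 0))) (∑-swap m n (λ i → F (suc i)))) (sym (∑-+ n (F 0) _))

∑-mul : ∀ m n (f g : ℕ → ℤ) → ∑ m f * ∑ n g ≡ ∑[ i < m ] ∑[ j < n ] (f i * g j)
∑-mul zero    n f g = refl
∑-mul (suc m) n f g = trans (ℤ.*-distribʳ-+ (∑ n g) (f 0) _)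
  (cong₂ _+_ (sym (∑-*ˡ n (f 0) g)) (∑-mul m n _ g))

∑-snoc : ∀ n (f : ℕ → ℤ) → ∑ (suc n) f ≡ ∑ n f + f n
∑-snoc zero    f = trans (ℤ.+-identityʳ (f 0)) (sym (ℤ.+-identityˡ (f 0)))
∑-snoc (suc n) f = trans (cong (_+_ (f 0)) (∑-snoc n _)) (sym (ℤ.+-assoc (f 0) _ _))

sumℤ-applyUpTo : ∀ n (f : ℕ → ℤ) (g : ℕ → ℕ) → sumℤ (map f (applyUpTo g n)) ≡ ∑[ i < n ] f (g i)
sumℤ-applyUpTo zero    f g = refl
sumℤ-applyUpTo (suc n) f g = cong (_+_ (f (g 0))) (sumℤ-applyUpTo n f (λ i → g (suc i)))

∑-palindrome : ∀ N (f : ℕ → ℤ) → (∀ i j → i ℕ.+ j ≡ N → f i ≡ f j) → (∀ i → i ℕ.+ i ≡ N → f i ≡ + 0) →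
  ∑ (suc N) f ≡ + 2 * ∑ (suc N / 2) f
∑-palindrome zero          f mirror centre = trans (ℤ.+-identityʳ (f 0)) (centre 0 refl)
∑-palindrome (suc zero)    f mirror centre = begin
  f 0 + (f 1 + + 0)  ≡⟨ cong (λ x → f 0 + (x + + 0)) (mirror 1 0 refl) ⟩
  f 0 + (f 0 + + 0)  ≡⟨ double (f 0) ⟩
  + 2 * (f 0 + + 0)  ∎
  where
  open ≡-Reasoning
  double : ∀ x → x + (x + + 0) ≡ + 2 * (x + + 0)
  double = solve-∀
∑-palindrome (suc (suc N)) f mirror centre = begin
  f 0 + ∑ (suc (suc N)) (λ i → f (suc i))
    ≡⟨ cong (_+_ (f 0)) (∑-snoc (suc N) (λ i → f (suc i))) ⟩
  f 0 + (∑ (suc N) (λ i → f (suc i)) + f (suc (suc N)))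
    ≡⟨ cong₂ (λ s x → f 0 + (s + x))
         (∑-palindrome N (λ i → f (suc i)) (λ i j eq → mirror (suc i) (suc j) (shift i j eq))
                                        (λ i eq → centre (suc i) (shift i i eq)))
         (mirror (suc (suc N)) 0 (ℕ.+-identityʳ _)) ⟩
  f 0 + (+ 2 * ∑ (suc N / 2) (λ i → f (suc i)) + f 0)
    ≡⟨ rearrange (f 0) _ ⟩
  + 2 * (f 0 + ∑ (suc N / 2) (λ i → f (suc i)))
    ≡⟨ cong (λ k → + 2 * ∑ k f) (m/n≡1+[m∸n]/n {suc (suc (suc N))} {2} (s≤s (s≤s z≤n))) ⟨
  + 2 * ∑ (suc (suc (suc N)) / 2) f ∎
  where
  open ≡-Reasoning
  shift : ∀ i j → i ℕ.+ j ≡ N → suc i ℕ.+ suc j ≡ suc (suc N)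
  shift i j eq = cong suc (trans (ℕ.+-suc i j) (cong suc eq))
  rearrange : ∀ x s → x + (+ 2 * s + x) ≡ + 2 * (x + s)
  rearrange = solve-∀

δ : ℕ → ℕ → ℤ
δ zero    zero    = + 1
δ zero    (suc _) = + 0
δ (suc _) zero    = + 0
δ (suc e) (suc d) = δ e d

∑-δ : ∀ {n e} → e < n → (a : ℕ → ℤ) → ∑[ d < n ] (δ e d * a d) ≡ a e
∑-δ {suc n} {zero}  _           a = trans (cong₂ _+_ (ℤ.*-identityˡ (a 0)) (∑-zero n (λ _ _ → refl)))
                                          (ℤ.+-identityʳ (a 0))
∑-δ {suc n} {suc e} (s≤s e<n) a = trans (ℤ.+-identityˡ _) (∑-δ e<n (λ d → a (suc d)))

∑-groupBy : ∀ T K (a : ℕ → ℤ) (e : ℕ → ℕ) (g : ℕ → ℤ) → (∀ i → i < T → e i < K) →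
  ∑[ i < T ] (a i * g (e i)) ≡ ∑[ d < K ] (∑[ i < T ] (δ (e i) d * a i) * g d)
∑-groupBy T K a e g e<K = begin
  ∑[ i < T ] (a i * g (e i))
    ≡⟨ ∑-cong T (λ i i<T → cong (a i *_) (sym (∑-δ (e<K i i<T) g))) ⟩
  ∑[ i < T ] (a i * ∑[ d < K ] (δ (e i) d * g d))
    ≡⟨ ∑-cong T (λ i _ → sym (∑-*ˡ K (a i) _)) ⟩
  ∑[ i < T ] ∑[ d < K ] (a i * (δ (e i) d * g d))
    ≡⟨ ∑-cong T (λ i _ → ∑-cong K (λ d _ → exchange (a i) (δ (e i) d) (g d))) ⟩
  ∑[ i < T ] ∑[ d < K ] (δ (e i) d * a i * g d)
    ≡⟨ ∑-swap T K _ ⟩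
  ∑[ d < K ] ∑[ i < T ] (δ (e i) d * a i * g d)
    ≡⟨ ∑-cong K (λ d _ → ∑-*ʳ T _ (g d)) ⟩
  ∑[ d < K ] (∑[ i < T ] (δ (e i) d * a i) * g d) ∎
  where
  open ≡-Reasoning
  exchange : ∀ x y z → x * (y * z) ≡ y * x * z
  exchange = solve-∀

∑²-groupBy : ∀ K L (a : ℕ → ℕ → ℤ) (e : ℕ → ℕ → ℕ) (g : ℕ → ℤ) → (∀ k l → k < K → l < K → e k l < L) →
  ∑[ k < K ] ∑[ l < K ] (a k l * g (e k l)) ≡ ∑[ d < L ] (∑[ k < K ] ∑[ l < K ] (δ (e k l) d * a k l) * g d)
∑²-groupBy K L a e g e<L = begin
  ∑[ k < K ] ∑[ l < K ] (a k l * g (e k l))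
    ≡⟨ ∑-cong K (λ k k<K → ∑-groupBy K L (a k) (e k) g (λ l l<K → e<L k l k<K l<K)) ⟩
  ∑[ k < K ] ∑[ d < L ] (∑[ l < K ] (δ (e k l) d * a k l) * g d)
    ≡⟨ ∑-swap K L _ ⟩
  ∑[ d < L ] ∑[ k < K ] (∑[ l < K ] (δ (e k l) d * a k l) * g d)
    ≡⟨ ∑-cong L (λ d _ → ∑-*ʳ K _ (g d)) ⟩
  ∑[ d < L ] (∑[ k < K ] ∑[ l < K ] (δ (e k l) d * a k l) * g d) ∎
  where open ≡-Reasoning

∣m-n∣<o : ∀ {m n o} → m < o → n < o → ℕ.∣ m - n ∣ < o
∣m-n∣<o {m} {n} m<o n<o = ℕ.≤-<-trans (ℕ.∣m-n∣≤m⊔n m n) (ℕ.⊔-lub m<o n<o)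

-- Vandermonde convolutions

vandermonde : ∀ a b r {T} → a < T → ∑[ i < T ] (binom a (+ i) * binom b (r - + i)) ≡ binom (a ℕ.+ b) r
vandermonde zero    b r {suc T} _         = begin
  + 1 * binom b (r - + 0) + ∑[ i < T ] (+ 0)
    ≡⟨ cong₂ _+_ (trans (ℤ.*-identityˡ _) (cong (binom b) (ℤ.+-identityʳ r))) (∑-zero T (λ _ _ → refl)) ⟩
  binom b r + + 0
    ≡⟨ ℤ.+-identityʳ _ ⟩
  binom b r ∎
  where open ≡-Reasoning
vandermonde (suc a) b r {suc T} (s≤s a<T) = begin
  ∑[ i < suc T ] (binom (suc a) (+ i) * X i)
    ≡⟨ ∑-cong (suc T) (λ i _ → trans (cong (_* X i) (binom-pascal a (+ i)))
                                     (ℤ.*-distribʳ-+ (X i) (binom a (+ i)) (binom a (+ i - + 1)))) ⟩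
  ∑[ i < suc T ] (binom a (+ i) * X i + binom a (+ i - + 1) * X i)
    ≡⟨ ∑-+ (suc T) (λ i → binom a (+ i) * X i) (λ i → binom a (+ i - + 1) * X i) ⟩
  ∑[ i < suc T ] (binom a (+ i) * X i) + ∑[ i < suc T ] (binom a (+ i - + 1) * X i)
    ≡⟨ cong₂ _+_ (vandermonde a b r (ℕ.m<n⇒m<1+n a<T)) shifted ⟩
  binom (a ℕ.+ b) r + binom (a ℕ.+ b) (r - + 1)
    ≡⟨ binom-pascal (a ℕ.+ b) r ⟨
  binom (suc a ℕ.+ b) r ∎
  where
  open ≡-Reasoning
  X : ℕ → ℤ
  X i = binom b (r - + i)
  index : ∀ r i → r - (+ 1 + i) ≡ r - + 1 - i
  index = solve-∀
  shifted : ∑[ i < suc T ] (binom a (+ i - + 1) * X i) ≡ binom (a ℕ.+ b) (r - + 1)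
  shifted = trans (ℤ.+-identityˡ _)
    (trans (∑-cong T (λ i _ → cong (λ j → binom a (+ i) * binom b j) (index r (+ i))))
           (vandermonde a b (r - + 1) a<T))

vandermonde-shifted : ∀ a b r k {T} → a ℕ.+ k < T →
  ∑[ j < T ] (binom a (+ j - + k) * binom b (r - + j)) ≡ binom (a ℕ.+ b) (r - + k)
vandermonde-shifted a b r zero    {T}     a<T = begin
  ∑[ j < T ] (binom a (+ j - + 0) * binom b (r - + j))
    ≡⟨ ∑-cong T (λ j _ → cong (λ i → binom a i * binom b (r - + j)) (ℤ.+-identityʳ (+ j))) ⟩
  ∑[ j < T ] (binom a (+ j) * binom b (r - + j))
    ≡⟨ vandermonde a b r (subst (_< T) (ℕ.+-identityʳ a) a<T) ⟩
  binom (a ℕ.+ b) r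
    ≡⟨ cong (binom (a ℕ.+ b)) (ℤ.+-identityʳ r) ⟨
  binom (a ℕ.+ b) (r - + 0) ∎
  where open ≡-Reasoning
vandermonde-shifted a b r (suc k) {suc T} a+k<T = begin
  + 0 + ∑[ j < T ] (binom a (+ suc j - + suc k) * binom b (r - + suc j))
    ≡⟨ ℤ.+-identityˡ _ ⟩
  ∑[ j < T ] (binom a (+ suc j - + suc k) * binom b (r - + suc j))
    ≡⟨ ∑-cong T (λ j _ → cong₂ (λ x y → binom a x * binom b y) (cancel (+ j) (+ k)) (index r (+ j))) ⟩
  ∑[ j < T ] (binom a (+ j - + k) * binom b (r - + 1 - + j))
    ≡⟨ vandermonde-shifted a b (r - + 1) k (ℕ.≤-pred (subst (_< suc T) (ℕ.+-suc a k) a+k<T)) ⟩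
  binom (a ℕ.+ b) (r - + 1 - + k)
    ≡⟨ cong (binom (a ℕ.+ b)) (index r (+ k)) ⟨
  binom (a ℕ.+ b) (r - + suc k) ∎
  where
  open ≡-Reasoning
  cancel : ∀ j k → (+ 1 + j) - (+ 1 + k) ≡ j - k
  cancel = solve-∀
  index : ∀ r i → r - (+ 1 + i) ≡ r - + 1 - i
  index = solve-∀

∑-binom-products : ∀ m k l {T} → m ℕ.+ k < T →
  ∑[ j < T ] (binom m (+ j - + k) * binom m (+ j - + l)) ≡ binom (m ℕ.+ m) (+ m + (+ l - + k))
∑-binom-products m k l {T} m+k<T = begin
  ∑[ j < T ] (binom m (+ j - + k) * binom m (+ j - + l))
    ≡⟨ ∑-cong T (λ j _ → cong (binom m (+ j - + k) *_)
                            (trans (binom-sym m (+ j - + l)) (cong (binom m) (reflect (+ m) (+ j) (+ l))))) ⟩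
  ∑[ j < T ] (binom m (+ j - + k) * binom m (+ m + + l - + j))
    ≡⟨ vandermonde-shifted m m (+ m + + l) k m+k<T ⟩
  binom (m ℕ.+ m) (+ m + + l - + k)
    ≡⟨ cong (binom (m ℕ.+ m)) (ℤ.+-assoc (+ m) (+ l) (- + k)) ⟩
  binom (m ℕ.+ m) (+ m + (+ l - + k)) ∎
  where
  open ≡-Reasoning
  reflect : ∀ m j l → m - (j - l) ≡ m + l - j
  reflect = solve-∀

∑-square-convolution : ∀ m K (c : ℕ → ℤ) {T} → m ℕ.+ K ≤ T →
  ∑[ j < T ] (∑[ k < K ] (c k * binom m (+ j - + k)) * ∑[ l < K ] (c l * binom m (+ j - + l)))
    ≡ ∑[ k < K ] ∑[ l < K ] (c k * c l * binom (m ℕ.+ m) (+ m + (+ l - + k)))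
∑-square-convolution m K c {T} m+K≤T = begin
  ∑[ j < T ] (∑[ k < K ] (c k * B j k) * ∑[ l < K ] (c l * B j l))
    ≡⟨ ∑-cong T (λ j _ → ∑-mul K K _ _) ⟩
  ∑[ j < T ] ∑[ k < K ] ∑[ l < K ] (c k * B j k * (c l * B j l))
    ≡⟨ ∑-swap T K _ ⟩
  ∑[ k < K ] ∑[ j < T ] ∑[ l < K ] (c k * B j k * (c l * B j l))
    ≡⟨ ∑-cong K (λ k _ → ∑-swap T K _) ⟩
  ∑[ k < K ] ∑[ l < K ] ∑[ j < T ] (c k * B j k * (c l * B j l))
    ≡⟨ ∑-cong K (λ k k<K → ∑-cong K (λ l _ → coefficient k l k<K)) ⟩
  ∑[ k < K ] ∑[ l < K ] (c k * c l * binom (m ℕ.+ m) (+ m + (+ l - + k))) ∎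
  where
  open ≡-Reasoning
  B : ℕ → ℕ → ℤ
  B j k = binom m (+ j - + k)
  rearrange : ∀ a x b y → a * x * (b * y) ≡ a * b * (x * y)
  rearrange = solve-∀
  coefficient : ∀ k l → k < K →
    ∑[ j < T ] (c k * B j k * (c l * B j l)) ≡ c k * c l * binom (m ℕ.+ m) (+ m + (+ l - + k))
  coefficient k l k<K = begin
    ∑[ j < T ] (c k * B j k * (c l * B j l))  ≡⟨ ∑-cong T (λ j _ → rearrange (c k) (B j k) (c l) (B j l)) ⟩
    ∑[ j < T ] (c k * c l * (B j k * B j l))  ≡⟨ ∑-*ˡ T (c k * c l) _ ⟩
    c k * c l * ∑[ j < T ] (B j k * B j l)    ≡⟨ cong (c k * c l *_) (∑-binom-products m k l m+k<T) ⟩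
    c k * c l * binom (m ℕ.+ m) (+ m + (+ l - + k)) ∎
    where
    m+k<T = ℕ.<-≤-trans (ℕ.+-monoʳ-< m k<K) m+K≤T

central : ℕ → ℕ → ℤ
central m d = binom (m ℕ.+ m) (+ (m ℕ.+ d))

central-distance : ∀ m l k → binom (m ℕ.+ m) (+ m + (+ l - + k)) ≡ central m ℕ.∣ l - k ∣
central-distance m zero    zero    = refl
central-distance m (suc l) zero    = cong (λ i → binom (m ℕ.+ m) (+ (m ℕ.+ i))) (ℕ.+-identityʳ (suc l))
central-distance m zero    (suc k) = begin
  binom (m ℕ.+ m) (+ m + -[1+ k ])
    ≡⟨ binom-sym (m ℕ.+ m) (+ m + -[1+ k ]) ⟩
  binom (m ℕ.+ m) (+ (m ℕ.+ m) - (+ m + -[1+ k ]))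
    ≡⟨ cong (λ M → binom (m ℕ.+ m) (M - (+ m + -[1+ k ]))) (ℤ.pos-+ m m) ⟩
  binom (m ℕ.+ m) (+ m + + m - (+ m + - + suc k))
    ≡⟨ cong (binom (m ℕ.+ m)) (reflect (+ m) (+ suc k)) ⟩
  central m (suc k) ∎
  where
  open ≡-Reasoning
  reflect : ∀ m k → m + m - (m + - k) ≡ m + k
  reflect = solve-∀
central-distance m (suc l) (suc k) =
  trans (cong (λ i → binom (m ℕ.+ m) (+ m + i)) (cancel (+ l) (+ k))) (central-distance m l k)
  where
  cancel : ∀ l k → (+ 1 + l) - (+ 1 + k) ≡ l - k
  cancel = solve-∀

central-ratio : ∀ m d → rising (+ m) d * central m d ≡ falling (+ m) d * central m 0
central-ratio m d = begin
  rising (+ m) d * binom (m ℕ.+ m) (+ (m ℕ.+ d))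
    ≡⟨ binom-rising (m ℕ.+ m) m d ⟩
  falling (+ (m ℕ.+ m) - + m) d * binom (m ℕ.+ m) (+ m)
    ≡⟨ cong₂ (λ x i → falling x d * binom (m ℕ.+ m) (+ i))
             (trans (cong (_- + m) (ℤ.pos-+ m m)) (cancel (+ m))) (sym (ℕ.+-identityʳ m)) ⟩
  falling (+ m) d * central m 0 ∎
  where
  open ≡-Reasoning
  cancel : ∀ m → m + m - m ≡ m
  cancel = solve-∀

-- Two-row characters as polynomial coefficients

-- The coefficient of X^j in (1 - X) ∏ᵢ (1 + X^μᵢ).
twoRowχ : List ℕ → ℤ → ℤ
twoRowχ []      (+ zero)     = + 1
twoRowχ []      (+ suc zero) = - + 1
twoRowχ []      _            = + 0
twoRowχ (k ∷ μ) j            = twoRowχ μ j + twoRowχ μ (j - + k)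

twoRowχ-negative : ∀ μ n → twoRowχ μ -[1+ n ] ≡ + 0
twoRowχ-negative []          n = refl
twoRowχ-negative (zero  ∷ μ) n = cong₂ _+_ (twoRowχ-negative μ n) (twoRowχ-negative μ n)
twoRowχ-negative (suc k ∷ μ) n = cong₂ _+_ (twoRowχ-negative μ n) (twoRowχ-negative μ (suc (n ℕ.+ k)))

twoRowχ-below : ∀ μ {i k} → i < k → twoRowχ μ (+ i - + k) ≡ + 0
twoRowχ-below μ {i} {suc k} i<k = trans (cong (twoRowχ μ) (m-[1+n]≡-[1+n∸m] i<k)) (twoRowχ-negative μ (k ∸ i))

twoRowχ-zero : ∀ μ → All (0 <_) μ → twoRowχ μ (+ 0) ≡ + 1
twoRowχ-zero []          All.[]               = refl
twoRowχ-zero (suc k ∷ μ) (_ All.∷ positive) = cong₂ _+_ (twoRowχ-zero μ positive) (twoRowχ-negative μ k)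

twoRowχ-antisym : ∀ μ y → twoRowχ μ (+ suc (sum μ) - y) ≡ - twoRowχ μ y
twoRowχ-antisym []      (+ zero)          = refl
twoRowχ-antisym []      (+ suc zero)      = refl
twoRowχ-antisym []      (+ suc (suc _))   = refl
twoRowχ-antisym []      -[1+ _ ]          = refl
twoRowχ-antisym (k ∷ μ) y = begin
  twoRowχ μ (+ 1 + (+ k + + s) - y) + twoRowχ μ (+ 1 + (+ k + + s) - y - + k)
    ≡⟨ cong₂ (λ i j → twoRowχ μ i + twoRowχ μ j) (shift₁ (+ k) (+ s) y) (shift₂ (+ k) (+ s) y) ⟩
  twoRowχ μ (+ suc s - (y - + k)) + twoRowχ μ (+ suc s - y)
    ≡⟨ cong₂ _+_ (twoRowχ-antisym μ (y - + k)) (twoRowχ-antisym μ y) ⟩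
  - twoRowχ μ (y - + k) + - twoRowχ μ y
    ≡⟨ negate-sum (twoRowχ μ y) (twoRowχ μ (y - + k)) ⟩
  - (twoRowχ μ y + twoRowχ μ (y - + k)) ∎
  where
  open ≡-Reasoning
  s = sum μ
  shift₁ : ∀ k s y → + 1 + (k + s) - y ≡ + 1 + s - (y - k)
  shift₁ = solve-∀
  shift₂ : ∀ k s y → + 1 + (k + s) - y - k ≡ + 1 + s - y
  shift₂ = solve-∀
  negate-sum : ∀ a b → - b + - a ≡ - (a + b)
  negate-sum = solve-∀

twoRowχ-mirror : ∀ μ {i j} → i ℕ.+ j ≡ suc (sum μ) → twoRowχ μ (+ j) ≡ - twoRowχ μ (+ i)
twoRowχ-mirror μ {i} eq = trans (cong (twoRowχ μ) (m+n≡o⇒n≡o-m eq)) (twoRowχ-antisym μ (+ i))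

twoRowχ-centre : ∀ μ {i} → i ℕ.+ i ≡ suc (sum μ) → twoRowχ μ (+ i) ≡ + 0
twoRowχ-centre μ eq = self-negative (twoRowχ-mirror μ eq)
  where
  self-negative : ∀ {a} → a ≡ - a → a ≡ + 0
  self-negative {+ zero} _ = refl

twoRowχ-ones : ∀ m y → twoRowχ (replicate m 1) y ≡ binom m y - binom m (y - + 1)
twoRowχ-ones zero    (+ zero)          = refl
twoRowχ-ones zero    (+ suc zero)      = refl
twoRowχ-ones zero    (+ suc (suc _))   = refl
twoRowχ-ones zero    -[1+ _ ]          = refl
twoRowχ-ones (suc m) y = begin
  twoRowχ (replicate m 1) y + twoRowχ (replicate m 1) (y - + 1)
    ≡⟨ cong₂ _+_ (twoRowχ-ones m y) (twoRowχ-ones m (y - + 1)) ⟩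
  (binom m y - binom m (y - + 1)) + (binom m (y - + 1) - binom m (y - + 1 - + 1))
    ≡⟨ telescope (binom m y) (binom m (y - + 1)) (binom m (y - + 1 - + 1)) ⟩
  (binom m y + binom m (y - + 1)) - (binom m (y - + 1) + binom m (y - + 1 - + 1))
    ≡⟨ cong₂ _-_ (binom-pascal m y) (binom-pascal m (y - + 1)) ⟨
  binom (suc m) y - binom (suc m) (y - + 1) ∎
  where
  open ≡-Reasoning
  telescope : ∀ a b c → (a - b) + (b - c) ≡ (a + b) - (b + c)
  telescope = solve-∀

-- The coefficients of (1 - X)(1 + X²)².
coefficient₂₂₁ : ℕ → ℤ
coefficient₂₂₁ 0 = + 1
coefficient₂₂₁ 1 = - + 1
coefficient₂₂₁ 2 = + 2
coefficient₂₂₁ 3 = - + 2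
coefficient₂₂₁ 4 = + 1
coefficient₂₂₁ 5 = - + 1
coefficient₂₂₁ _ = + 0

twoRowχ-221 : ∀ m y → twoRowχ (2 ∷ 2 ∷ replicate m 1) y ≡ ∑[ k < 6 ] (coefficient₂₂₁ k * binom m (y - + k))
twoRowχ-221 m y = begin
  (D y + D (y - + 2)) + (D (y - + 2) + D (y - + 2 - + 2))
    ≡⟨ cong₂ (λ i j → (D i + D (y - + 2)) + (D (y - + 2) + D j)) (sym (ℤ.+-identityʳ y)) (shift y) ⟩
  (D (y - + 0) + D (y - + 2)) + (D (y - + 2) + D (y - + 4))
    ≡⟨ cong₂ (λ a b → (a + b) + (b + D (y - + 4))) (shifted 0) (shifted 2) ⟩
  ((B 0 - B 1) + (B 2 - B 3)) + ((B 2 - B 3) + D (y - + 4))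
    ≡⟨ cong (λ c → ((B 0 - B 1) + (B 2 - B 3)) + ((B 2 - B 3) + c)) (shifted 4) ⟩
  ((B 0 - B 1) + (B 2 - B 3)) + ((B 2 - B 3) + (B 4 - B 5))
    ≡⟨ expand (B 0) (B 1) (B 2) (B 3) (B 4) (B 5) ⟩
  ∑[ k < 6 ] (coefficient₂₂₁ k * B k) ∎
  where
  open ≡-Reasoning
  D : ℤ → ℤ
  D = twoRowχ (replicate m 1)
  B : ℕ → ℤ
  B k = binom m (y - + k)
  shift : ∀ y → y - + 2 - + 2 ≡ y - + 4
  shift = solve-∀
  index : ∀ y k → y - k - + 1 ≡ y - (+ 1 + k)
  index = solve-∀
  shifted : ∀ k → D (y - + k) ≡ B k - B (suc k)
  shifted k = trans (twoRowχ-ones m (y - + k)) (cong (λ i → B k - binom m i) (index y (+ k)))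
  expand : ∀ b₀ b₁ b₂ b₃ b₄ b₅ → ((b₀ - b₁) + (b₂ - b₃)) + ((b₂ - b₃) + (b₄ - b₅))
    ≡ + 1 * b₀ + (- + 1 * b₁ + (+ 2 * b₂ + (- + 2 * b₃ + (+ 1 * b₄ + (- + 1 * b₅ + + 0)))))
  expand = solve-∀

-- The Murnaghan–Nakayama rule on one and two beads

T⇒≡true : ∀ {b} → T b → b ≡ true
T⇒≡true = Equivalence.to T-≡

¬T⇒≡false : ∀ {b} → ¬ T b → b ≡ false
¬T⇒≡false ¬t = ¬-not (¬t ∘ Equivalence.from T-≡)

∈ᵇ⇒∈ : ∀ {z} B → T (z ∈ᵇ B) → z ∈ B
∈ᵇ⇒∈ {z} (x ∷ B) t with Equivalence.to (T-∨ {z ≡ᵇ x} {z ∈ᵇ B}) t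
... | inj₁ z≡ᵇx = here (ℕ.≡ᵇ⇒≡ z x z≡ᵇx)
... | inj₂ z∈ᵇB = there (∈ᵇ⇒∈ B z∈ᵇB)

∈⇒∈ᵇ : ∀ {z B} → z ∈ B → T (z ∈ᵇ B)
∈⇒∈ᵇ {z} {x ∷ B} (here refl) = Equivalence.from (T-∨ {z ≡ᵇ z} {z ∈ᵇ B}) (inj₁ (ℕ.≡⇒≡ᵇ z z refl))
∈⇒∈ᵇ {z} {x ∷ B} (there z∈B) = Equivalence.from (T-∨ {z ≡ᵇ x} {z ∈ᵇ B}) (inj₂ (∈⇒∈ᵇ z∈B))

between-≥ : ∀ {a b c} B → b ≤ c → between a b (c ∷ B) ≡ between a b B
between-≥ {a} {b} {c} B b≤c = cong (λ t → (if t then 1 else 0) ℕ.+ between a b B)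
  (trans (cong ((a <ᵇ c) ∧_) (¬T⇒≡false (ℕ.≤⇒≯ b≤c ∘ ℕ.<ᵇ⇒< c b))) (∧-zeroʳ (a <ᵇ c)))

between-≤ : ∀ {a b c} B → c ≤ a → between a b (c ∷ B) ≡ between a b B
between-≤ {a} {b} {c} B c≤a = cong (λ t → (if t ∧ (c <ᵇ b) then 1 else 0) ℕ.+ between a b B)
  (¬T⇒≡false (ℕ.≤⇒≯ c≤a ∘ ℕ.<ᵇ⇒< a c))

between-inside : ∀ {a b c} B → a < c → c < b → between a b (c ∷ B) ≡ suc (between a b B)
between-inside {a} {b} {c} B a<c c<b = cong₂ (λ t u → (if t ∧ u then 1 else 0) ℕ.+ between a b B)
  (T⇒≡true (ℕ.<⇒<ᵇ a<c)) (T⇒≡true (ℕ.<⇒<ᵇ c<b))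

replace-here : ∀ b b′ B → replace b b′ (b ∷ B) ≡ b′ ∷ replace b b′ B
replace-here b b′ B = cong (λ t → (if t then b′ else b) ∷ replace b b′ B) (T⇒≡true (ℕ.≡⇒≡ᵇ b b refl))

replace-there : ∀ {b c} b′ B → b ≢ c → replace b b′ (c ∷ B) ≡ c ∷ replace b b′ B
replace-there {b} {c} b′ B b≢c = cong (λ t → (if t then b′ else c) ∷ replace b b′ B)
  (¬T⇒≡false (b≢c ∘ ℕ.≡ᵇ⇒≡ b c))

hookRemoval : List ℕ → ℕ → ℕ → List ℕ → ℤ
hookRemoval B b k μ = sign (between (b ∸ k) b B) * mn (replace b (b ∸ k) B) μ

-- The summand of mnSum for the bead b: mnSum B (b ∷ bs) k μ reduces to rimHook B b k μ + mnSum B bs k μ.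
rimHook : List ℕ → ℕ → ℕ → List ℕ → ℤ
rimHook B b k μ = if (k ≤ᵇ b) ∧ not ((b ∸ k) ∈ᵇ B) ∧ not (k ≡ᵇ 0) then hookRemoval B b k μ else + 0

rimHook-if : ∀ B b k μ {c} → (k ≤ᵇ b) ∧ not ((b ∸ k) ∈ᵇ B) ∧ not (k ≡ᵇ 0) ≡ c →
  rimHook B b k μ ≡ (if c then hookRemoval B b k μ else + 0)
rimHook-if B b k μ = cong (λ c → if c then hookRemoval B b k μ else + 0)

rimHook-tooLong : ∀ B {b k} μ → b < k → rimHook B b k μ ≡ + 0
rimHook-tooLong B {b} {k} μ b<k =
  rimHook-if B b k μ (cong (_∧ not ((b ∸ k) ∈ᵇ B) ∧ not (k ≡ᵇ 0)) (¬T⇒≡false (ℕ.<⇒≱ b<k ∘ ℕ.≤ᵇ⇒≤ k b)))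

rimHook-occupied : ∀ B {b k} μ → b ∸ k ∈ B → rimHook B b k μ ≡ + 0
rimHook-occupied B {b} {k} μ occupied = rimHook-if B b k μ
  (trans (cong (λ t → (k ≤ᵇ b) ∧ not t ∧ not (k ≡ᵇ 0)) (T⇒≡true (∈⇒∈ᵇ occupied))) (∧-zeroʳ (k ≤ᵇ b)))

rimHook-free : ∀ B {b} k μ → suc k ≤ b → b ∸ suc k ∉ B → rimHook B b (suc k) μ ≡ hookRemoval B b (suc k) μ
rimHook-free B {b} k μ k<b free = rimHook-if B b (suc k) μ
  (cong₂ (λ t u → t ∧ not u ∧ true) (T⇒≡true (ℕ.≤⇒≤ᵇ k<b)) (¬T⇒≡false (free ∘ ∈ᵇ⇒∈ B)))

rimHook-top-crossing : ∀ {x y} k μ → suc k ≤ x → x ∸ suc k < y → y < x →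
  rimHook (x ∷ y ∷ []) x (suc k) μ ≡ - mn (x ∸ suc k ∷ y ∷ []) μ
rimHook-top-crossing {x} {y} k μ k<x z<y y<x = begin
  rimHook (x ∷ y ∷ []) x (suc k) μ
    ≡⟨ rimHook-free (x ∷ y ∷ []) k μ k<x
         (λ { (here z≡x) → ℕ.<⇒≢ (ℕ.<-trans z<y y<x) z≡x ; (there (here z≡y)) → ℕ.<⇒≢ z<y z≡y }) ⟩
  sign (between z x (x ∷ y ∷ [])) * mn (replace x z (x ∷ y ∷ [])) μ
    ≡⟨ cong₂ (λ n B → sign n * mn B μ)
         (trans (between-≥ {z} {x} (y ∷ []) ℕ.≤-refl) (between-inside [] z<y y<x))
         (trans (replace-here x z (y ∷ [])) (cong (z ∷_) (replace-there z [] (ℕ.<⇒≢ y<x ∘ sym)))) ⟩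
  sign 1 * mn (z ∷ y ∷ []) μ
    ≡⟨ ℤ.-1*i≡-i _ ⟩
  - mn (z ∷ y ∷ []) μ ∎
  where
  open ≡-Reasoning
  z = x ∸ suc k

rimHook-top-clear : ∀ {x y} k μ → suc k ≤ x → y < x ∸ suc k →
  rimHook (x ∷ y ∷ []) x (suc k) μ ≡ mn (x ∸ suc k ∷ y ∷ []) μ
rimHook-top-clear {x} {y} k μ k<x y<z = begin
  rimHook (x ∷ y ∷ []) x (suc k) μ
    ≡⟨ rimHook-free (x ∷ y ∷ []) k μ k<x
         (λ { (here z≡x) → ℕ.<⇒≢ z<x z≡x ; (there (here z≡y)) → ℕ.<⇒≢ y<z (sym z≡y) }) ⟩
  sign (between z x (x ∷ y ∷ [])) * mn (replace x z (x ∷ y ∷ [])) μ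
    ≡⟨ cong₂ (λ n B → sign n * mn B μ)
         (trans (between-≥ {z} {x} (y ∷ []) ℕ.≤-refl) (between-≤ {z} {x} [] (ℕ.<⇒≤ y<z)))
         (trans (replace-here x z (y ∷ [])) (cong (z ∷_) (replace-there z [] (ℕ.<⇒≢ y<x ∘ sym)))) ⟩
  + 1 * mn (z ∷ y ∷ []) μ
    ≡⟨ ℤ.*-identityˡ _ ⟩
  mn (z ∷ y ∷ []) μ ∎
  where
  open ≡-Reasoning
  z = x ∸ suc k
  z<x : z < x
  z<x = ℕ.∸-monoʳ-< {o = 0} (s≤s z≤n) k<x
  y<x : y < x
  y<x = ℕ.<-trans y<z z<x

rimHook-bottom : ∀ {x y} k μ → suc k ≤ y → y < x →
  rimHook (x ∷ y ∷ []) y (suc k) μ ≡ mn (x ∷ y ∸ suc k ∷ []) μ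
rimHook-bottom {x} {y} k μ k<y y<x = begin
  rimHook (x ∷ y ∷ []) y (suc k) μ
    ≡⟨ rimHook-free (x ∷ y ∷ []) k μ k<y
         (λ { (here z≡x) → ℕ.<⇒≢ (ℕ.<-trans z<y y<x) z≡x ; (there (here z≡y)) → ℕ.<⇒≢ z<y z≡y }) ⟩
  sign (between z y (x ∷ y ∷ [])) * mn (replace y z (x ∷ y ∷ [])) μ
    ≡⟨ cong₂ (λ n B → sign n * mn B μ)
         (trans (between-≥ {z} {y} (y ∷ []) (ℕ.<⇒≤ y<x)) (between-≥ {z} {y} [] ℕ.≤-refl))
         (trans (replace-there z (y ∷ []) (ℕ.<⇒≢ y<x)) (cong (x ∷_) (replace-here y z []))) ⟩
  + 1 * mn (x ∷ z ∷ []) μ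
    ≡⟨ ℤ.*-identityˡ _ ⟩
  mn (x ∷ z ∷ []) μ ∎
  where
  open ≡-Reasoning
  z = y ∸ suc k
  z<y : z < y
  z<y = ℕ.∸-monoʳ-< {o = 0} (s≤s z≤n) k<y

mn-swap : ∀ μ a b → mn (a ∷ b ∷ []) μ ≡ mn (b ∷ a ∷ []) μ
mn-swap []      a b = cong (λ t → if t then + 1 else + 0) (∧-swap (a <ᵇ 2) (b <ᵇ 2))
  where
  ∧-swap : ∀ p q → p ∧ (q ∧ true) ≡ q ∧ (p ∧ true)
  ∧-swap false false = refl
  ∧-swap false true  = refl
  ∧-swap true  false = refl
  ∧-swap true  true  = refl
mn-swap (k ∷ μ) a b = begin
  rimHook (a ∷ b ∷ []) a k μ + (rimHook (a ∷ b ∷ []) b k μ + + 0)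
    ≡⟨ cong₂ (λ u v → u + (v + + 0)) (rimHook-swap a) (rimHook-swap b) ⟩
  rimHook (b ∷ a ∷ []) a k μ + (rimHook (b ∷ a ∷ []) b k μ + + 0)
    ≡⟨ +-swap (rimHook (b ∷ a ∷ []) a k μ) (rimHook (b ∷ a ∷ []) b k μ) ⟩
  rimHook (b ∷ a ∷ []) b k μ + (rimHook (b ∷ a ∷ []) a k μ + + 0) ∎
  where
  open ≡-Reasoning
  +-swap : ∀ u v → u + (v + + 0) ≡ v + (u + + 0)
  +-swap = solve-∀
  ∨-swap : ∀ p q → p ∨ (q ∨ false) ≡ q ∨ (p ∨ false)
  ∨-swap false false = refl
  ∨-swap false true  = refl
  ∨-swap true  false = refl
  ∨-swap true  true  = refl
  count-swap : ∀ p q → p ℕ.+ (q ℕ.+ 0) ≡ q ℕ.+ (p ℕ.+ 0)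
  count-swap p q = trans (cong (p ℕ.+_) (ℕ.+-identityʳ q))
    (trans (ℕ.+-comm p q) (cong (q ℕ.+_) (sym (ℕ.+-identityʳ p))))
  rimHook-swap : ∀ c → rimHook (a ∷ b ∷ []) c k μ ≡ rimHook (b ∷ a ∷ []) c k μ
  rimHook-swap c = cong₂ (λ t h → if (k ≤ᵇ c) ∧ not t ∧ not (k ≡ᵇ 0) then h else + 0)
    (∨-swap ((c ∸ k) ≡ᵇ a) ((c ∸ k) ≡ᵇ b))
    (cong₂ (λ n h → sign n * h)
      (count-swap (if ((c ∸ k) <ᵇ a) ∧ (a <ᵇ c) then 1 else 0) (if ((c ∸ k) <ᵇ b) ∧ (b <ᵇ c) then 1 else 0))
      (mn-swap μ (if c ≡ᵇ a then c ∸ k else a) (if c ≡ᵇ b then c ∸ k else b)))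

mn-one-bead : ∀ μ → All (0 <_) μ → mn (sum μ ∷ []) μ ≡ + 1
mn-one-bead []          All.[]  = refl
mn-one-bead (suc k ∷ μ) (_ All.∷ positive) = begin
  rimHook (x ∷ []) x (suc k) μ + + 0
    ≡⟨ ℤ.+-identityʳ _ ⟩
  rimHook (x ∷ []) x (suc k) μ
    ≡⟨ rimHook-free (x ∷ []) k μ k<x (λ { (here z≡x) → ℕ.<⇒≢ (ℕ.∸-monoʳ-< {o = 0} (s≤s z≤n) k<x) z≡x }) ⟩
  sign (between z x (x ∷ [])) * mn (replace x z (x ∷ [])) μ
    ≡⟨ cong₂ (λ n B → sign n * mn B μ) (between-≥ {z} {x} [] ℕ.≤-refl) (replace-here x z []) ⟩
  + 1 * mn (z ∷ []) μ
    ≡⟨ ℤ.*-identityˡ _ ⟩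
  mn (z ∷ []) μ
    ≡⟨ cong (λ b → mn (b ∷ []) μ) (ℕ.m+n∸m≡n (suc k) (sum μ)) ⟩
  mn (sum μ ∷ []) μ
    ≡⟨ mn-one-bead μ positive ⟩
  + 1 ∎
  where
  open ≡-Reasoning
  x = suc k ℕ.+ sum μ
  z = x ∸ suc k
  k<x : suc k ≤ x
  k<x = ℕ.m≤m+n (suc k) (sum μ)

TwoBeadFormula : List ℕ → Set
TwoBeadFormula μ = ∀ {x y} → y < x → x ℕ.+ y ≡ suc (sum μ) → mn (x ∷ y ∷ []) μ ≡ twoRowχ μ (+ y)

m+n≡k+o⇒[m∸k]+n≡o : ∀ {m n k o} → k ≤ m → m ℕ.+ n ≡ k ℕ.+ o → (m ∸ k) ℕ.+ n ≡ o
m+n≡k+o⇒[m∸k]+n≡o {m} {n} {k} {o} k≤m eq = ℕ.+-cancelˡ-≡ k _ _ (begin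
  k ℕ.+ ((m ∸ k) ℕ.+ n)  ≡⟨ ℕ.+-assoc k (m ∸ k) n ⟨
  k ℕ.+ (m ∸ k) ℕ.+ n    ≡⟨ cong (ℕ._+ n) (ℕ.m+[n∸m]≡n k≤m) ⟩
  m ℕ.+ n                ≡⟨ eq ⟩
  k ℕ.+ o                ∎)
  where open ≡-Reasoning

rimHook-top≡twoRowχ : ∀ {k μ} → TwoBeadFormula μ → ∀ {x y} → y < x → x ℕ.+ y ≡ suc k ℕ.+ suc (sum μ) →
  rimHook (x ∷ y ∷ []) x (suc k) μ ≡ - twoRowχ μ (+ x - + suc k)
rimHook-top≡twoRowχ {k} {μ} formula {x} {y} y<x eq with suc k ℕ.≤? x
... | no  k≮x = trans (rimHook-tooLong (x ∷ y ∷ []) {x} {suc k} μ (ℕ.≰⇒> k≮x))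
                      (cong -_ (sym (twoRowχ-below μ (ℕ.≰⇒> k≮x))))
... | yes k<x with ℕ.<-cmp (x ∸ suc k) y | m+n≡k+o⇒[m∸k]+n≡o k<x eq
...   | tri< z<y _ _ | z+y≡ = begin
  rimHook (x ∷ y ∷ []) x (suc k) μ  ≡⟨ rimHook-top-crossing k μ k<x z<y y<x ⟩
  - mn (z ∷ y ∷ []) μ               ≡⟨ cong -_ (mn-swap μ z y) ⟩
  - mn (y ∷ z ∷ []) μ               ≡⟨ cong -_ (formula z<y (trans (ℕ.+-comm y z) z+y≡)) ⟩
  - twoRowχ μ (+ z)                 ≡⟨ cong (-_ ∘ twoRowχ μ) (pos-∸ k<x) ⟨
  - twoRowχ μ (+ x - + suc k)       ∎
  where
  open ≡-Reasoning
  z = x ∸ suc k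
...   | tri≈ _ z≡y _ | z+y≡ = begin
  rimHook (x ∷ y ∷ []) x (suc k) μ  ≡⟨ rimHook-occupied (x ∷ y ∷ []) {x} {suc k} μ (there (here z≡y)) ⟩
  + 0                               ≡⟨ cong -_ (twoRowχ-centre μ (trans (cong (z ℕ.+_) z≡y) z+y≡)) ⟨
  - twoRowχ μ (+ z)                 ≡⟨ cong (-_ ∘ twoRowχ μ) (pos-∸ k<x) ⟨
  - twoRowχ μ (+ x - + suc k)       ∎
  where
  open ≡-Reasoning
  z = x ∸ suc k
...   | tri> _ _ y<z | z+y≡ = begin
  rimHook (x ∷ y ∷ []) x (suc k) μ  ≡⟨ rimHook-top-clear k μ k<x y<z ⟩
  mn (z ∷ y ∷ []) μ                 ≡⟨ formula y<z z+y≡ ⟩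
  twoRowχ μ (+ y)                   ≡⟨ twoRowχ-mirror μ z+y≡ ⟩
  - twoRowχ μ (+ z)                 ≡⟨ cong (-_ ∘ twoRowχ μ) (pos-∸ k<x) ⟨
  - twoRowχ μ (+ x - + suc k)       ∎
  where
  open ≡-Reasoning
  z = x ∸ suc k

rimHook-bottom≡twoRowχ : ∀ {k μ} → TwoBeadFormula μ → ∀ {x y} → y < x → x ℕ.+ y ≡ suc k ℕ.+ suc (sum μ) →
  rimHook (x ∷ y ∷ []) y (suc k) μ ≡ twoRowχ μ (+ y - + suc k)
rimHook-bottom≡twoRowχ {k} {μ} formula {x} {y} y<x eq with suc k ℕ.≤? y
... | no  k≮y = trans (rimHook-tooLong (x ∷ y ∷ []) {y} {suc k} μ (ℕ.≰⇒> k≮y))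
                      (sym (twoRowχ-below μ (ℕ.≰⇒> k≮y)))
... | yes k≤y = begin
  rimHook (x ∷ y ∷ []) y (suc k) μ  ≡⟨ rimHook-bottom k μ k≤y y<x ⟩
  mn (x ∷ z ∷ []) μ                 ≡⟨ formula (ℕ.≤-<-trans (ℕ.m∸n≤m y (suc k)) y<x) x+z≡ ⟩
  twoRowχ μ (+ z)                   ≡⟨ cong (twoRowχ μ) (pos-∸ k≤y) ⟨
  twoRowχ μ (+ y - + suc k)         ∎
  where
  open ≡-Reasoning
  z = y ∸ suc k
  x+z≡ : x ℕ.+ z ≡ suc (sum μ)
  x+z≡ = trans (ℕ.+-comm x z) (m+n≡k+o⇒[m∸k]+n≡o k≤y (trans (ℕ.+-comm y x) eq))

twoBeadFormula : ∀ μ → All (0 <_) μ → TwoBeadFormula μ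
twoBeadFormula []          All.[] {suc zero}    {zero}  _         _  = refl
twoBeadFormula []          All.[] {suc zero}    {suc y} (s≤s ())  _
twoBeadFormula []          All.[] {suc (suc x)} {y}     _         ()
twoBeadFormula (suc k ∷ μ) (_ All.∷ positive) {x} {y} y<x eq = begin
  rimHook (x ∷ y ∷ []) x (suc k) μ + (rimHook (x ∷ y ∷ []) y (suc k) μ + + 0)
    ≡⟨ cong₂ (λ u v → u + (v + + 0)) (rimHook-top≡twoRowχ {k} {μ} IH y<x eq′)
                                     (rimHook-bottom≡twoRowχ {k} {μ} IH y<x eq′) ⟩
  - twoRowχ μ (+ x - + suc k) + (twoRowχ μ (+ y - + suc k) + + 0)
    ≡⟨ cong₂ _+_ (sym mirror) (ℤ.+-identityʳ _) ⟩
  twoRowχ μ (+ y) + twoRowχ μ (+ y - + suc k) ∎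
  where
  open ≡-Reasoning
  IH = twoBeadFormula μ positive
  eq′ : x ℕ.+ y ≡ suc k ℕ.+ suc (sum μ)
  eq′ = trans eq (cong suc (sym (ℕ.+-suc k (sum μ))))
  reflect : ∀ k s x → + 1 + (k + s) - x ≡ + 1 + s - (x - k)
  reflect = solve-∀
  mirror : twoRowχ μ (+ y) ≡ - twoRowχ μ (+ x - + suc k)
  mirror = trans (cong (twoRowχ μ) (trans (m+n≡o⇒n≡o-m eq) (reflect (+ suc k) (+ sum μ) (+ x))))
                 (twoRowχ-antisym μ (+ x - + suc k))

χ-twoRow : ∀ μ → All (0 <_) μ → ∀ {n j} → sum μ ≡ n → j ℕ.+ j ≤ n → χ (twoRow n j) μ ≡ twoRowχ μ (+ j)
χ-twoRow μ positive {j = zero}  refl _ = begin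
  mn (sum μ ℕ.+ 0 ∷ []) μ  ≡⟨ cong (λ b → mn (b ∷ []) μ) (ℕ.+-identityʳ (sum μ)) ⟩
  mn (sum μ ∷ []) μ        ≡⟨ mn-one-bead μ positive ⟩
  + 1                      ≡⟨ twoRowχ-zero μ positive ⟨
  twoRowχ μ (+ 0)          ∎
  where open ≡-Reasoning
χ-twoRow μ positive {n} {suc j} refl 2j≤n = begin
  mn ((n ∸ suc j) ℕ.+ 1 ∷ suc j ℕ.+ 0 ∷ []) μ
    ≡⟨ cong₂ (λ x y → mn (x ∷ y ∷ []) μ) (ℕ.+-comm (n ∸ suc j) 1) (ℕ.+-identityʳ (suc j)) ⟩
  mn (suc (n ∸ suc j) ∷ suc j ∷ []) μ
    ≡⟨ twoBeadFormula μ positive (s≤s (ℕ.m+n≤o⇒m≤o∸n (suc j) 2j≤n))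
                                 (cong suc (ℕ.m∸n+n≡m (ℕ.m+n≤o⇒n≤o (suc j) 2j≤n))) ⟩
  twoRowχ μ (+ suc j) ∎
  where open ≡-Reasoning

-- The sum of squares and the central binomial coefficient

sum-type221 : ∀ m → sum (type221 (4 ℕ.+ m)) ≡ 4 ℕ.+ m
sum-type221 m = cong (4 ℕ.+_) (sum-ones m)
  where
  sum-ones : ∀ m → sum (replicate m 1) ≡ m
  sum-ones zero    = refl
  sum-ones (suc m) = cong suc (sum-ones m)

type221-positive : ∀ m → All (0 <_) (type221 (4 ℕ.+ m))
type221-positive m = s≤s z≤n All.∷ s≤s z≤n All.∷ replicate⁺ m (s≤s z≤n)

j<n/2+1⇒j+j≤n : ∀ {n j} → j < n / 2 ℕ.+ 1 → j ℕ.+ j ≤ n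
j<n/2+1⇒j+j≤n {n} {j} j<K = begin
  j ℕ.+ j                ≤⟨ ℕ.+-mono-≤ j≤half j≤half ⟩
  n / 2 ℕ.+ n / 2        ≡⟨ cong (n / 2 ℕ.+_) (ℕ.+-identityʳ (n / 2)) ⟨
  2 ℕ.* (n / 2)          ≡⟨ ℕ.*-comm 2 (n / 2) ⟩
  n / 2 ℕ.* 2            ≤⟨ m/n*n≤m n 2 ⟩
  n                      ∎
  where
  open ℕ.≤-Reasoning
  j≤half : j ≤ n / 2
  j≤half = ℕ.≤-pred (subst (j <_) (ℕ.+-comm (n / 2) 1) j<K)

twice-lhs-as-squares : ∀ m → let μ = type221 (4 ℕ.+ m) in
  + 2 * lhs (4 ℕ.+ m) ≡ ∑[ j < 6 ℕ.+ m ] (twoRowχ μ (+ j) * twoRowχ μ (+ j))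
twice-lhs-as-squares m = begin
  + 2 * lhs n
    ≡⟨ cong (+ 2 *_) (sumℤ-applyUpTo K (λ j → χ (twoRow n j) μ * χ (twoRow n j) μ) (λ j → j)) ⟩
  + 2 * ∑[ j < K ] (χ (twoRow n j) μ * χ (twoRow n j) μ)
    ≡⟨ cong (+ 2 *_) (∑-cong K (λ j j<K → cong (λ a → a * a)
         (χ-twoRow μ (type221-positive m) (sum-type221 m) (j<n/2+1⇒j+j≤n j<K)))) ⟩
  + 2 * ∑[ j < K ] f j
    ≡⟨ cong (λ k → + 2 * ∑ k f) (trans (ℕ.+-comm (n / 2) 1) (sym (m/n≡1+[m∸n]/n {suc (suc n)} {2} (s≤s (s≤s z≤n))))) ⟩
  + 2 * ∑ (suc (suc n) / 2) f
    ≡⟨ ∑-palindrome (suc n) f mirror centre ⟨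
  ∑[ j < suc (suc n) ] f j ∎
  where
  open ≡-Reasoning
  n = 4 ℕ.+ m
  μ = type221 n
  K = n / 2 ℕ.+ 1
  f : ℕ → ℤ
  f j = twoRowχ μ (+ j) * twoRowχ μ (+ j)
  size : ∀ {i j} → i ℕ.+ j ≡ suc n → i ℕ.+ j ≡ suc (sum μ)
  size eq = trans eq (cong suc (sym (sum-type221 m)))
  negated-square : ∀ a → - a * - a ≡ a * a
  negated-square = solve-∀
  mirror : ∀ i j → i ℕ.+ j ≡ suc n → f i ≡ f j
  mirror i j eq = trans (sym (negated-square (twoRowχ μ (+ i))))
                        (cong (λ a → a * a) (sym (twoRowχ-mirror μ (size {i} {j} eq))))
  centre : ∀ i → i ℕ.+ i ≡ suc n → f i ≡ + 0
  centre i eq = cong (λ a → a * a) (twoRowχ-centre μ (size {i} {i} eq))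

-- Evaluates to 12, -20, 16, -10, 4, -2 for d = 0, …, 5.
lhsWeight : ℕ → ℤ
lhsWeight d = ∑[ k < 6 ] ∑[ l < 6 ] (δ ℕ.∣ l - k ∣ d * (coefficient₂₂₁ k * coefficient₂₂₁ l))

twice-lhs-weighted : ∀ m → + 2 * lhs (4 ℕ.+ m) ≡ ∑[ d < 6 ] (lhsWeight d * central m d)
twice-lhs-weighted m = begin
  + 2 * lhs (4 ℕ.+ m)
    ≡⟨ twice-lhs-as-squares m ⟩
  ∑[ j < 6 ℕ.+ m ] (twoRowχ μ (+ j) * twoRowχ μ (+ j))
    ≡⟨ ∑-cong (6 ℕ.+ m) (λ j _ → cong (λ a → a * a) (twoRowχ-221 m (+ j))) ⟩
  ∑[ j < 6 ℕ.+ m ] (∑[ k < 6 ] (c k * binom m (+ j - + k)) * ∑[ l < 6 ] (c l * binom m (+ j - + l)))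
    ≡⟨ ∑-square-convolution m 6 c (ℕ.≤-reflexive (ℕ.+-comm m 6)) ⟩
  ∑[ k < 6 ] ∑[ l < 6 ] (c k * c l * binom (m ℕ.+ m) (+ m + (+ l - + k)))
    ≡⟨ ∑-cong 6 (λ k _ → ∑-cong 6 (λ l _ → cong (c k * c l *_) (central-distance m l k))) ⟩
  ∑[ k < 6 ] ∑[ l < 6 ] (c k * c l * central m ℕ.∣ l - k ∣)
    ≡⟨ ∑²-groupBy 6 6 (λ k l → c k * c l) (λ k l → ℕ.∣ l - k ∣) (central m) (λ k l k<6 l<6 → ∣m-n∣<o l<6 k<6) ⟩
  ∑[ d < 6 ] (lhsWeight d * central m d) ∎
  where
  open ≡-Reasoning
  μ = type221 (4 ℕ.+ m)
  c = coefficient₂₂₁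

-- Evaluates to 70, 112, 56, 16, 2 for d = 0, …, 4 and to 0 beyond.
binomWeight : ℕ → ℤ
binomWeight d = ∑[ i < 9 ] (δ ℕ.∣ 4 - i ∣ d * binom 8 (+ i))

central-binomial-weighted : ∀ m → + ((2 ℕ.* (4 ℕ.+ m)) C (4 ℕ.+ m)) ≡ ∑[ d < 9 ] (binomWeight d * central m d)
central-binomial-weighted m = begin
  binom (2 ℕ.* (4 ℕ.+ m)) (+ (4 ℕ.+ m))
    ≡⟨ cong (λ N → binom N (+ (4 ℕ.+ m))) (double m) ⟩
  binom (8 ℕ.+ (m ℕ.+ m)) (+ (4 ℕ.+ m))
    ≡⟨ vandermonde 8 (m ℕ.+ m) (+ (4 ℕ.+ m)) {9} ℕ.≤-refl ⟨
  ∑[ i < 9 ] (binom 8 (+ i) * binom (m ℕ.+ m) (+ 4 + + m - + i))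
    ≡⟨ ∑-cong 9 (λ i _ → cong (binom 8 (+ i) *_)
                          (trans (cong (binom (m ℕ.+ m)) (recentre (+ m) (+ i))) (central-distance m 4 i))) ⟩
  ∑[ i < 9 ] (binom 8 (+ i) * central m ℕ.∣ 4 - i ∣)
    ≡⟨ ∑-groupBy 9 9 (λ i → binom 8 (+ i)) (λ i → ℕ.∣ 4 - i ∣) (central m)
                 (λ i i<9 → ∣m-n∣<o {4} (s≤s (s≤s (s≤s (s≤s (s≤s z≤n))))) i<9) ⟩
  ∑[ d < 9 ] (binomWeight d * central m d) ∎
  where
  open ≡-Reasoning
  double : ∀ m → 2 ℕ.* (4 ℕ.+ m) ≡ 8 ℕ.+ (m ℕ.+ m)
  double = ℕ-Solver.solve-∀
  recentre : ∀ m i → + 4 + m - i ≡ m + (+ 4 - i)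
  recentre = solve-∀

-- The closing polynomial identity

-- The d-th product is (M + 1)⋯(M + 5) C(2M, M + d) / C(2M, M), and the weights are lhsWeight and binomWeight.
polynomial-identity : ∀ M g →
  (+ 2 * (M + + 4) - + 1) * (+ 2 * (M + + 4) - + 3) * (+ 2 * (M + + 4) - + 5) * (+ 2 * (M + + 4) - + 7)
    * (M + + 4 + + 1)
  * ((+ 12 * ((M + + 1) * (M + + 2) * (M + + 3) * (M + + 4) * (M + + 5))
     + (- + 20 * (M * (M + + 2) * (M + + 3) * (M + + 4) * (M + + 5))
     + (+ 16 * (M * (M - + 1) * (M + + 3) * (M + + 4) * (M + + 5))
     + (- + 10 * (M * (M - + 1) * (M - + 2) * (M + + 4) * (M + + 5))
     + (+ 4 * (M * (M - + 1) * (M - + 2) * (M - + 3) * (M + + 5))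
     + (- + 2 * (M * (M - + 1) * (M - + 2) * (M - + 3) * (M - + 4)) + + 0)))))) * g)
  ≡ + 2 * ((M + + 4) * (M + + 4) * (M + + 4) * (M + + 4) - + 14 * ((M + + 4) * (M + + 4) * (M + + 4))
           + + 89 * ((M + + 4) * (M + + 4)) - + 316 * (M + + 4) + + 525)
  * ((+ 70 * ((M + + 1) * (M + + 2) * (M + + 3) * (M + + 4) * (M + + 5))
     + (+ 112 * (M * (M + + 2) * (M + + 3) * (M + + 4) * (M + + 5))
     + (+ 56 * (M * (M - + 1) * (M + + 3) * (M + + 4) * (M + + 5))
     + (+ 16 * (M * (M - + 1) * (M - + 2) * (M + + 4) * (M + + 5))
     + (+ 2 * (M * (M - + 1) * (M - + 2) * (M - + 3) * (M + + 5))
     + (+ 0 * (M * (M - + 1) * (M - + 2) * (M - + 3) * (M - + 4)) + + 0)))))) * g)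
polynomial-identity = solve-∀

cong₅ : ∀ {a₁ a₂ b₁ b₂ c₁ c₂ d₁ d₂ e₁ e₂ : ℤ} (f : ℤ → ℤ → ℤ → ℤ → ℤ → ℤ) →
  a₁ ≡ a₂ → b₁ ≡ b₂ → c₁ ≡ c₂ → d₁ ≡ d₂ → e₁ ≡ e₂ → f a₁ b₁ c₁ d₁ e₁ ≡ f a₂ b₂ c₂ d₂ e₂
cong₅ f refl refl refl refl refl = refl

scale-by-rising : ∀ M w₀ w₁ w₂ w₃ w₄ w₅ g₀ g₁ g₂ g₃ g₄ g₅ →
  rising M 1 * g₁ ≡ falling M 1 * g₀ → rising M 2 * g₂ ≡ falling M 2 * g₀ →
  rising M 3 * g₃ ≡ falling M 3 * g₀ → rising M 4 * g₄ ≡ falling M 4 * g₀ →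
  rising M 5 * g₅ ≡ falling M 5 * g₀ →
  rising M 5 * (w₀ * g₀ + (w₁ * g₁ + (w₂ * g₂ + (w₃ * g₃ + (w₄ * g₄ + (w₅ * g₅ + + 0))))))
    ≡ (w₀ * ((M + + 1) * (M + + 2) * (M + + 3) * (M + + 4) * (M + + 5))
       + (w₁ * (M * (M + + 2) * (M + + 3) * (M + + 4) * (M + + 5))
       + (w₂ * (M * (M - + 1) * (M + + 3) * (M + + 4) * (M + + 5))
       + (w₃ * (M * (M - + 1) * (M - + 2) * (M + + 4) * (M + + 5))
       + (w₄ * (M * (M - + 1) * (M - + 2) * (M - + 3) * (M + + 5))
       + (w₅ * (M * (M - + 1) * (M - + 2) * (M - + 3) * (M - + 4)) + + 0)))))) * g₀
scale-by-rising M w₀ w₁ w₂ w₃ w₄ w₅ g₀ g₁ g₂ g₃ g₄ g₅ r₁ r₂ r₃ r₄ r₅ = begin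
  (M + + 1) * (M + + 2) * (M + + 3) * (M + + 4) * (M + + 5)
    * (w₀ * g₀ + (w₁ * g₁ + (w₂ * g₂ + (w₃ * g₃ + (w₄ * g₄ + (w₅ * g₅ + + 0))))))
    ≡⟨ solve (M ∷ w₀ ∷ w₁ ∷ w₂ ∷ w₃ ∷ w₄ ∷ w₅ ∷ g₀ ∷ g₁ ∷ g₂ ∷ g₃ ∷ g₄ ∷ g₅ ∷ []) ⟩
  w₀ * ((M + + 1) * (M + + 2) * (M + + 3) * (M + + 4) * (M + + 5)) * g₀
    + w₁ * ((M + + 2) * (M + + 3) * (M + + 4) * (M + + 5)) * ((M + + 1) * g₁)
    + w₂ * ((M + + 3) * (M + + 4) * (M + + 5)) * ((M + + 1) * (M + + 2) * g₂)
    + w₃ * ((M + + 4) * (M + + 5)) * ((M + + 1) * (M + + 2) * (M + + 3) * g₃)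
    + w₄ * (M + + 5) * ((M + + 1) * (M + + 2) * (M + + 3) * (M + + 4) * g₄)
    + w₅ * ((M + + 1) * (M + + 2) * (M + + 3) * (M + + 4) * (M + + 5) * g₅)
    ≡⟨ cong₅ (λ a b c d e → w₀ * ((M + + 1) * (M + + 2) * (M + + 3) * (M + + 4) * (M + + 5)) * g₀
         + w₁ * ((M + + 2) * (M + + 3) * (M + + 4) * (M + + 5)) * a + w₂ * ((M + + 3) * (M + + 4) * (M + + 5)) * b
         + w₃ * ((M + + 4) * (M + + 5)) * c + w₄ * (M + + 5) * d + w₅ * e) r₁ r₂ r₃ r₄ r₅ ⟩
  w₀ * ((M + + 1) * (M + + 2) * (M + + 3) * (M + + 4) * (M + + 5)) * g₀
    + w₁ * ((M + + 2) * (M + + 3) * (M + + 4) * (M + + 5)) * (M * g₀)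
    + w₂ * ((M + + 3) * (M + + 4) * (M + + 5)) * (M * (M - + 1) * g₀)
    + w₃ * ((M + + 4) * (M + + 5)) * (M * (M - + 1) * (M - + 2) * g₀)
    + w₄ * (M + + 5) * (M * (M - + 1) * (M - + 2) * (M - + 3) * g₀)
    + w₅ * (M * (M - + 1) * (M - + 2) * (M - + 3) * (M - + 4) * g₀)
    ≡⟨ solve (M ∷ w₀ ∷ w₁ ∷ w₂ ∷ w₃ ∷ w₄ ∷ w₅ ∷ g₀ ∷ []) ⟩
  (w₀ * ((M + + 1) * (M + + 2) * (M + + 3) * (M + + 4) * (M + + 5))
       + (w₁ * (M * (M + + 2) * (M + + 3) * (M + + 4) * (M + + 5))
       + (w₂ * (M * (M - + 1) * (M + + 3) * (M + + 4) * (M + + 5))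
       + (w₃ * (M * (M - + 1) * (M - + 2) * (M + + 4) * (M + + 5))
       + (w₄ * (M * (M - + 1) * (M - + 2) * (M - + 3) * (M + + 5))
       + (w₅ * (M * (M - + 1) * (M - + 2) * (M - + 3) * (M - + 4)) + + 0)))))) * g₀ ∎
  where open ≡-Reasoning

powers-unfold : ∀ x → x ^ 4 - + 14 * x ^ 3 + + 89 * x ^ 2 - + 316 * x + + 525
                     ≡ x * x * x * x - + 14 * (x * x * x) + + 89 * (x * x) - + 316 * x + + 525
powers-unfold x = begin
  x * (x * (x * (x * + 1))) - + 14 * (x * (x * (x * + 1))) + + 89 * (x * (x * + 1)) - + 316 * x + + 525
    ≡⟨ solve (x ∷ []) ⟩
  x * x * x * x - + 14 * (x * x * x) + + 89 * (x * x) - + 316 * x + + 525 ∎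
  where open ≡-Reasoning

-- The last two hypotheses are ∑[ d < 6 ] (lhsWeight d * g d) and ∑[ d < 9 ] (binomWeight d * g d) evaluated,
-- which is how mainTheorem14 supplies them.
closing-identity : ∀ M {N N₂ L B g₀ g₁ g₂ g₃ g₄ g₅ : ℤ} .{{_ : NonZero (rising M 5)}} →
  N ≡ M + + 4 → N₂ ≡ + 2 * N →
  rising M 1 * g₁ ≡ falling M 1 * g₀ → rising M 2 * g₂ ≡ falling M 2 * g₀ →
  rising M 3 * g₃ ≡ falling M 3 * g₀ → rising M 4 * g₄ ≡ falling M 4 * g₀ →
  rising M 5 * g₅ ≡ falling M 5 * g₀ →
  + 2 * L ≡ + 12 * g₀ + (- + 20 * g₁ + (+ 16 * g₂ + (- + 10 * g₃ + (+ 4 * g₄ + (- + 2 * g₅ + + 0))))) →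
  B ≡ + 70 * g₀ + (+ 112 * g₁ + (+ 56 * g₂ + (+ 16 * g₃ + (+ 2 * g₄ + (+ 0 * g₅ + + 0))))) →
  L * ((N₂ - + 1) * (N₂ - + 3) * (N₂ - + 5) * (N₂ - + 7) * (N + + 1))
    ≡ (N ^ 4 - + 14 * N ^ 3 + + 89 * N ^ 2 - + 316 * N + + 525) * B
closing-identity M {L = L} {B} {g₀} {g₁} {g₂} {g₃} {g₄} {g₅} refl refl r₁ r₂ r₃ r₄ r₅ twice-L≡ B≡ =
  ℤ.*-cancelˡ-≡ (+ 2 * P) (L * den) (num * B) {{ℤ.i*j≢0 (+ 2) P}} (begin
    + 2 * P * (L * den)       ≡⟨ regroupˡ P L den ⟩
    den * (P * (+ 2 * L))     ≡⟨ cong (λ x → den * (P * x)) twice-L≡ ⟩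
    _                         ≡⟨ cong (den *_) (scale-by-rising M (+ 12) (- + 20) (+ 16) (- + 10) (+ 4) (- + 2)
                                                                g₀ g₁ g₂ g₃ g₄ g₅ r₁ r₂ r₃ r₄ r₅) ⟩
    _                         ≡⟨ polynomial-identity M g₀ ⟩
    _                         ≡⟨ cong (+ 2 * num′ *_) (scale-by-rising M (+ 70) (+ 112) (+ 56) (+ 16) (+ 2) (+ 0)
                                                                       g₀ g₁ g₂ g₃ g₄ g₅ r₁ r₂ r₃ r₄ r₅) ⟨
    _                         ≡⟨ cong (λ x → + 2 * num′ * (P * x)) B≡ ⟨
    + 2 * num′ * (P * B)      ≡⟨ cong (λ x → + 2 * x * (P * B)) (powers-unfold (M + + 4)) ⟨
    + 2 * num * (P * B)       ≡⟨ regroupʳ P num B ⟩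
    + 2 * P * (num * B)       ∎)
  where
  open ≡-Reasoning
  P = rising M 5
  N = M + + 4
  den = (+ 2 * N - + 1) * (+ 2 * N - + 3) * (+ 2 * N - + 5) * (+ 2 * N - + 7) * (N + + 1)
  num = N ^ 4 - + 14 * N ^ 3 + + 89 * N ^ 2 - + 316 * N + + 525
  num′ = N * N * N * N - + 14 * (N * N * N) + + 89 * (N * N) - + 316 * N + + 525
  regroupˡ : ∀ p l d → + 2 * p * (l * d) ≡ d * (p * (+ 2 * l))
  regroupˡ = solve-∀
  regroupʳ : ∀ p n b → + 2 * n * (p * b) ≡ + 2 * p * (n * b)
  regroupʳ = solve-∀

mainTheorem14 : (n : ℕ) → 4 ≤ n →
    lhs n * ((+ (2 ℕ.* n) - + 1) * (+ (2 ℕ.* n) - + 3) * (+ (2 ℕ.* n) - + 5) * (+ (2 ℕ.* n) - + 7) * (+ n + + 1))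
      ≡ ((+ n) ^ 4 - + 14 * (+ n) ^ 3 + + 89 * (+ n) ^ 2 - + 316 * (+ n) + + 525) * + ((2 ℕ.* n) C n)
mainTheorem14 n@(suc (suc (suc (suc m)))) (s≤s (s≤s (s≤s (s≤s z≤n)))) =
  closing-identity (+ m) {{rising-nonZero m 5}} (cong +_ (ℕ.+-comm 4 m)) (ℤ.pos-* 2 n)
    (central-ratio m 1) (central-ratio m 2) (central-ratio m 3) (central-ratio m 4) (central-ratio m 5)
    (twice-lhs-weighted m) (central-binomial-weighted m)
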